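{- Let $(\mathcal W,\rhd)$ be a $\lambda\mathbf A$-frame and $\eta$ a hereditary type environment. If the subtyping judgment $\gamma\vdash A\preceq B$ is derivable and $\eta\models\gamma$, then $\mathcal I(A)^\eta_p\subseteq\mathcal I(B)^\eta_p$ for every $p\in\mathcal W$.
   Context: Type expressions. Pseudo type expressions: $A::=X\mid A\to B\mid\bullet A\mid\mu X.A$ ($\alpha$-equivalent ones identified; $A[B/X]$ capture-avoiding substitution; $\mathrm{FTV}(A)$ the free type variables). $\top:=\mu X.\bullet X$. Tail: $t(X)=X$, $t(A\to B)=t(B)$, $t(\bullet A)=\bullet t(A)$, $t(\mu X.A)=\mu X.t(A)$. $A$ is a $\top$-variant iff $t(A)=\bullet^{m_0}\mu X_1.\bullet^{m_1}\cdots\mu X_n.\bullet^{m_n}X_i$ with $1\le i\le n$, $X_i\notin\{X_{i+1},\dots,X_n\}$, $m_i+\dots+m_n\ge1$. Properness in $X$: variable $Y$ iff $Y\ne X$; $\bullet A$ always; $A\to B$ iff both are or $B$ is a $\top$-variant; $\mu Y.A$ ($Y\ne X$) iff $A$ is or $\mu Y.A$ is a $\top$-variant. Type expressions: every subexpression $\mu X.A$ has $A$ proper in $X$. Equality $\simeq$: smallest relation closed under reflexivity, symmetry, transitivity; $A\simeq B\Rightarrow\bullet A\simeq\bullet B$; $A\simeq C,B\simeq D\Rightarrow A\to B\simeq C\to D$; $A\to\top\simeq\top$; $\mu X.A\simeq A[\mu X.A/X]$; if $A\simeq C[A/X]$ with $C$ proper in $X$ then $A\simeq\mu X.C$; $\bullet(A\to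 B)\simeq\bullet A\to\bullet B$. Subtyping. A subtyping assumption $\gamma$ is a finite set of pairs written $X\preceq Y$ of type variables in which every type variable occurs at most once; $\mathrm{FTV}(\gamma)$ is the set of variables in it; in the rules all unions must again be subtyping assumptions. Rules: $\gamma\cup\{X\preceq Y\}\vdash X\preceq Y$; $\gamma\vdash A\preceq\top$; if $A\simeq B$ then $\gamma\vdash A\preceq B$; from $\gamma_1\vdash A\preceq B$ and $\gamma_2\vdash B\preceq C$ infer $\gamma_1\cup\gamma_2\vdash A\preceq C$; from $\gamma\vdash A\preceq B$ infer $\gamma\vdash\bullet A\preceq\bullet B$; from $\gamma_1\vdash A'\preceq A$ and $\gamma_2\vdash B\preceq B'$ infer $\gamma_1\cup\gamma_2\vdash A\to B\preceq A'\to B'$; from $\gamma\cup\{X\preceq Y\}\vdash A\preceq B$ infer $\gamma\vdash\mu X.A\preceq\mu Y.B$ provided $X\notin\mathrm{FTV}(\gamma)\cup\mathrm{FTV}(B)$, $Y\notin\mathrm{FTV}(\gamma)\cup\mathrm{FTV}(A)$, $A$ proper in $X$ and $B$ proper in $Y$; $\gamma\vdash A\preceq\bullet A$. Semantics. Fix a syntactical $\lambda$-algebra $(\mathcal V,\cdot,[\![\,]\!])$ ($[\![x]\!]_\rho=\rho(x)$, $[\![MN]\!]_\rho=[\![M]\!]_\rho\cdot[\![N]\!]_\rho$, $[\![\lambda x.M]\!]_\rho\cdot v=[\![M]\!]_{\rho[v/x]}$, dependence only on free variables, invariance under $=_\beta$). A $\lambda\mathbf A$-frame $(\mathcal W,\rhd)$: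 nonempty $\mathcal W$ without infinite chains $p_0\rhd p_1\rhd\cdots$, locally linear: with $\unrhd^*$ the reflexive transitive closure, if $p\rhd q$ there is $r$ with $p\unrhd^*r\rhd q$ and $r\rhd s\Rightarrow q\unrhd^*s$. Hereditary type environment: $\eta(X)_p\subseteq\mathcal V$ with $p\rhd q\Rightarrow\eta(X)_p\subseteq\eta(X)_q$. $\eta\models\gamma$ means $\eta(X)_p\subseteq\eta(Y)_p$ for all $p$ whenever $X\preceq Y\in\gamma$. Interpretation: $\mathcal I(A)^\eta_p=\mathcal V$ for $\top$-variants; else $\mathcal I(X)^\eta_p=\eta(X)_p$; $\mathcal I(\bullet A)^\eta_p=\{u\mid\forall q(p\rhd q\Rightarrow u\in\mathcal I(A)^\eta_q)\}$; $\mathcal I(A\to B)^\eta_p=\{u\mid\forall q(p\unrhd^* q)\forall v\in\mathcal I(A)^\eta_q: u\cdot v\in\mathcal I(B)^\eta_q\}$; $\mathcal I(\mu X.A)^\eta_p=\mathcal I(A[\mu X.A/X])^\eta_p$. -}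

module Defs where

open import Data.Nat using (ℕ; zero; suc; _<_; _≟_)
open import Data.Bool using (Bool; true; false)
open import Data.List using (List; []; _∷_; _++_; map)
open import Data.List.Membership.Propositional using (_∈_)
open import Data.Product using (Σ; ∃; _×_; _,_)
open import Data.Sum using (_⊎_)
open import Data.Unit using (⊤; tt)
open import Data.Empty using (⊥)
open import Relation.Nullary using (¬_; yes; no)
open import Relation.Binary.PropositionalEquality using (_≡_; _≢_)
open import Relation.Binary.Construct.Closure.ReflexiveTransitive using (Star)
open import Induction.WellFounded using (WellFounded)

data Λ : Set where
  var : ℕ → Λ
  app : Λ → Λ → Λ
  lam : Λ → Λ

ext : (ℕ → ℕ) → ℕ → ℕ
ext ρ zero    = zero
ext ρ (suc n) = suc (ρ n)

ren : (ℕ → ℕ) → Λ → Λ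
ren ρ (var x)   = var (ρ x)
ren ρ (app M N) = app (ren ρ M) (ren ρ N)
ren ρ (lam M)   = lam (ren (ext ρ) M)

exts : (ℕ → Λ) → ℕ → Λ
exts σ zero    = var zero
exts σ (suc n) = ren suc (σ n)

sub : (ℕ → Λ) → Λ → Λ
sub σ (var x)   = σ x
sub σ (app M N) = app (sub σ M) (sub σ N)
sub σ (lam M)   = lam (sub (exts σ) M)

sub0 : Λ → ℕ → Λ
sub0 N zero    = N
sub0 N (suc n) = var n

data _=β_ : Λ → Λ → Set where
  β     : ∀ M N → app (lam M) N =β sub (sub0 N) M
  refl  : ∀ M → M =β M
  sym   : ∀ {M N} → M =β N → N =β M
  trans : ∀ {M N P} → M =β N → N =β P → M =β P
  appc  : ∀ {M M' N N'} → M =β M' → N =β N' → app M N =β app M' N'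
  lamc  : ∀ {M M'} → M =β M' → lam M =β lam M'

FV : ℕ → Λ → Set
FV x (var y)   = x ≡ y
FV x (app M N) = FV x M ⊎ FV x N
FV x (lam M)   = FV (suc x) M

_∷ᵉ_ : {V : Set} → V → (ℕ → V) → ℕ → V
(v ∷ᵉ ρ) zero    = v
(v ∷ᵉ ρ) (suc n) = ρ n

record LambdaAlgebra : Set₁ where
  field
    V      : Set
    _·_    : V → V → V
    ⟦_⟧_   : Λ → (ℕ → V) → V
    ⟦var⟧  : ∀ x ρ → ⟦ var x ⟧ ρ ≡ ρ x
    ⟦app⟧  : ∀ M N ρ → ⟦ app M N ⟧ ρ ≡ (⟦ M ⟧ ρ) · (⟦ N ⟧ ρ)
    ⟦lam⟧  : ∀ M ρ v → (⟦ lam M ⟧ ρ) · v ≡ ⟦ M ⟧ (v ∷ᵉ ρ)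
    ⟦fv⟧   : ∀ M ρ ρ' → (∀ x → FV x M → ρ x ≡ ρ' x) → ⟦ M ⟧ ρ ≡ ⟦ M ⟧ ρ'
    ⟦β⟧    : ∀ M N ρ → M =β N → ⟦ M ⟧ ρ ≡ ⟦ N ⟧ ρ

record Frame : Set₁ where
  field
    W    : Set
    _▷_  : W → W → Set
    inhabitant : W
    -- no infinite chains p₀ ▷ p₁ ▷ ⋯ (constructive form: accessibility)
    wf▷  : WellFounded (λ q p → p ▷ q)
    locLin : ∀ {p q} → p ▷ q →
      Σ W λ r → Star _▷_ p r × r ▷ q × (∀ s → r ▷ s → Star _▷_ q s)

-- Type expressions, locally nameless:
-- free type variables are names fvar X (X : ℕ), bound ones de Bruijn indices.

infixr 5 _⇒_
data Ty : Set where
  fvar : ℕ → Ty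
  bvar : ℕ → Ty
  _⇒_  : Ty → Ty → Ty
  ●    : Ty → Ty
  μ    : Ty → Ty

openAt : ℕ → Ty → Ty → Ty
openAt k U (fvar X) = fvar X
openAt k U (bvar i) with i ≟ k
... | yes _ = U
... | no  _ = bvar i
openAt k U (A ⇒ B) = openAt k U A ⇒ openAt k U B
openAt k U (● A)   = ● (openAt k U A)
openAt k U (μ A)   = μ (openAt (suc k) U A)

open′ : Ty → Ty → Ty
open′ A U = openAt 0 U A

⊤ᵗ : Ty
⊤ᵗ = μ (● (bvar 0))

_∈FTV_ : ℕ → Ty → Set
X ∈FTV fvar Y  = X ≡ Y
X ∈FTV bvar _  = ⊥
X ∈FTV (A ⇒ B) = X ∈FTV A ⊎ X ∈FTV B
X ∈FTV ● A     = X ∈FTV A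
X ∈FTV μ A     = X ∈FTV A

tail : Ty → Ty
tail (fvar X) = fvar X
tail (bvar i) = bvar i
tail (A ⇒ B)  = tail B
tail (● A)    = ● (tail A)
tail (μ A)    = μ (tail A)

-- GuardedChain bs A : A is ●^{m} μ ●^{m} ... μ ●^{m} (bound variable), where
-- bs records, for each enclosing μ of the chain (innermost first), whether
-- a ● has occurred since that binder.
guardedAt : List Bool → ℕ → Set
guardedAt []       _       = ⊥
guardedAt (b ∷ _)  zero    = b ≡ true
guardedAt (_ ∷ bs) (suc n) = guardedAt bs n

GuardedChain : List Bool → Ty → Set
GuardedChain bs (fvar _) = ⊥
GuardedChain bs (bvar i) = guardedAt bs i
GuardedChain bs (_ ⇒ _)  = ⊥
GuardedChain bs (● A)    = GuardedChain (map (λ _ → true) bs) A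
GuardedChain bs (μ A)    = GuardedChain (false ∷ bs) A

TopVariant : Ty → Set
TopVariant A = GuardedChain [] (tail A)

proper : ℕ → Ty → Set
proper k (fvar _) = ⊤
proper k (bvar i) = i ≢ k
proper k (A ⇒ B)  = (proper k A × proper k B) ⊎ TopVariant B
proper k (● A)    = ⊤
proper k (μ A)    = proper (suc k) A ⊎ TopVariant (μ A)

-- wf n A : A is a type expression under n enclosing binders
-- (locally closed, every μ-body proper in its bound variable)
wf : ℕ → Ty → Set
wf n (fvar _) = ⊤
wf n (bvar i) = i < n
wf n (A ⇒ B)  = wf n A × wf n B
wf n (● A)    = wf n A
wf n (μ A)    = wf (suc n) A × proper 0 A

TypeExpr : Ty → Set
TypeExpr = wf 0

infix 4 _≃_
data _≃_ : Ty → Ty → Set where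
  ≃-refl  : ∀ {A} → TypeExpr A → A ≃ A
  ≃-sym   : ∀ {A B} → A ≃ B → B ≃ A
  ≃-trans : ∀ {A B C} → A ≃ B → B ≃ C → A ≃ C
  ≃-●     : ∀ {A B} → A ≃ B → ● A ≃ ● B
  ≃-⇒     : ∀ {A B C D} → A ≃ C → B ≃ D → (A ⇒ B) ≃ (C ⇒ D)
  ≃-⇒⊤    : ∀ {A} → TypeExpr A → (A ⇒ ⊤ᵗ) ≃ ⊤ᵗ
  ≃-unfold : ∀ {A} → TypeExpr (μ A) → μ A ≃ open′ A (μ A)
  -- A ≃ C[A/X], C proper in X  ⟹  A ≃ μX.C   (C given as a μ-body)
  ≃-fold  : ∀ {A C} → TypeExpr A → TypeExpr (μ C) → A ≃ open′ C A → A ≃ μ C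
  ≃-●⇒    : ∀ {A B} → TypeExpr A → TypeExpr B → ● (A ⇒ B) ≃ (● A ⇒ ● B)

-- Subtyping assumptions: finite sets of pairs X ≼ Y, represented by lists
-- (considered up to having the same elements)

Assumptions : Set
Assumptions = List (ℕ × ℕ)

_∈FTVₐ_ : ℕ → Assumptions → Set
X ∈FTVₐ γ = ∃ λ Y → ((X , Y) ∈ γ) ⊎ ((Y , X) ∈ γ)

-- every type variable occurs at most once
IsAssumption : Assumptions → Set
IsAssumption γ =
  (∀ {X Y} → (X , Y) ∈ γ → X ≢ Y) ×
  (∀ {X Y X' Y'} → (X , Y) ∈ γ → (X' , Y') ∈ γ →
     (X ≡ X' ⊎ X ≡ Y' ⊎ Y ≡ X' ⊎ Y ≡ Y') → (X ≡ X' × Y ≡ Y'))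

_≋_ : Assumptions → Assumptions → Set
γ ≋ γ' = ∀ x → (x ∈ γ → x ∈ γ') × (x ∈ γ' → x ∈ γ)

infix 3 _⊢_≼_
data _⊢_≼_ : Assumptions → Ty → Ty → Set where
  ≼-set   : ∀ {γ γ' A B} → γ ≋ γ' → γ ⊢ A ≼ B → γ' ⊢ A ≼ B
  ≼-hyp   : ∀ {γ X Y} → IsAssumption γ → (X , Y) ∈ γ → γ ⊢ fvar X ≼ fvar Y
  ≼-⊤     : ∀ {γ A} → IsAssumption γ → TypeExpr A → γ ⊢ A ≼ ⊤ᵗ
  ≼-≃     : ∀ {γ A B} → IsAssumption γ → A ≃ B → γ ⊢ A ≼ B
  ≼-trans : ∀ {γ₁ γ₂ A B C} → IsAssumption (γ₁ ++ γ₂) →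
            γ₁ ⊢ A ≼ B → γ₂ ⊢ B ≼ C → γ₁ ++ γ₂ ⊢ A ≼ C
  ≼-●     : ∀ {γ A B} → γ ⊢ A ≼ B → γ ⊢ ● A ≼ ● B
  ≼-⇒     : ∀ {γ₁ γ₂ A A' B B'} → IsAssumption (γ₁ ++ γ₂) →
            γ₁ ⊢ A' ≼ A → γ₂ ⊢ B ≼ B' → γ₁ ++ γ₂ ⊢ (A ⇒ B) ≼ (A' ⇒ B')
  -- μX.A ≼ μY.B, with A, B given as μ-bodies and X, Y the chosen names
  ≼-μ     : ∀ {γ A B} (X Y : ℕ) →
            ¬ (X ∈FTV A) → ¬ (Y ∈FTV B) →
            IsAssumption ((X , Y) ∷ γ) →
            ¬ (X ∈FTVₐ γ) → ¬ (X ∈FTV open′ B (fvar Y)) →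
            ¬ (Y ∈FTVₐ γ) → ¬ (Y ∈FTV open′ A (fvar X)) →
            proper 0 A → proper 0 B →
            ((X , Y) ∷ γ) ⊢ open′ A (fvar X) ≼ open′ B (fvar Y) →
            γ ⊢ μ A ≼ μ B
  ≼-next  : ∀ {γ A} → IsAssumption γ → TypeExpr A → γ ⊢ A ≼ ● A

module Semantics (𝓐 : LambdaAlgebra) (𝓕 : Frame) where
  open LambdaAlgebra 𝓐
  open Frame 𝓕

  TyEnv : Set₁
  TyEnv = ℕ → W → V → Set

  Hereditary : TyEnv → Set
  Hereditary η = ∀ X {p q} → p ▷ q → ∀ u → η X p u → η X q u

  _⊨_ : TyEnv → Assumptions → Set
  η ⊨ γ = ∀ {X Y} → (X , Y) ∈ γ → ∀ p u → η X p u → η Y p u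

  _⇔_ : Set → Set → Set
  P ⇔ Q = (P → Q) × (Q → P)

  -- I is the interpretation 𝓘(-)^η : it satisfies the defining clauses
  -- on all type expressions
  record IsInterpretation (η : TyEnv) (I : Ty → W → V → Set) : Set where
    field
      I-top : ∀ {A} → TypeExpr A → TopVariant A → ∀ p u → I A p u
      I-var : ∀ X → ¬ TopVariant (fvar X) → ∀ p u → I (fvar X) p u ⇔ η X p u
      I-●   : ∀ {A} → TypeExpr (● A) → ¬ TopVariant (● A) → ∀ p u →
              I (● A) p u ⇔ (∀ q → p ▷ q → I A q u)
      I-⇒   : ∀ {A B} → TypeExpr (A ⇒ B) → ¬ TopVariant (A ⇒ B) → ∀ p u →
              I (A ⇒ B) p u ⇔
                (∀ q → Star _▷_ p q → ∀ v → I A q v → I B q (u · v))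
      I-μ   : ∀ {A} → TypeExpr (μ A) → ¬ TopVariant (μ A) → ∀ p u →
              I (μ A) p u ⇔ I (open′ A (μ A)) p u

{-# OPTIONS --safe #-}

-- The strict future of a world is well-founded, so for every environment η there
-- is a canonical interpretation 𝓘 η, defined by recursion on worlds and types:
-- since μ-bodies are proper, the variable bound by μ A need only denote μ A at
-- strictly later worlds. By the same induction on worlds any two families satisfying
-- the defining clauses agree on type expressions, so it suffices to show that 𝓘
-- validates the rules. Folding is uniqueness of guarded fixed points, ●(A → B) ≃
-- ●A → ●B uses local linearity, and the μ-rule is an induction on worlds in the
-- environment reading X as μ A and Y as μ A ∪ μ B; this change of environment is
-- why 𝓘 is needed for all η and not only for the given one.

module Submission where

open import Defs hiding (sym; trans)
open import Data.Bool using (true; false)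
open import Data.Empty using (⊥; ⊥-elim)
open import Data.List using (List; []; _∷_; _++_; map; length)
open import Data.List.Membership.Propositional.Properties using (∈-++⁺ˡ; ∈-++⁺ʳ)
open import Data.List.Properties using (length-map)
open import Data.List.Relation.Unary.All using (All; []; _∷_)
open import Data.List.Relation.Unary.Any using (here; there)
open import Data.Nat using (ℕ; zero; suc; _+_; _<_; _≤_; _≟_; z≤n; s≤s)
open import Data.Nat.Properties
  using (<-≤-trans; <⇒≢; <⇒≤; ≤-refl; ≤∧≢⇒<; m<1+n⇒m≤n; suc-injective; +-suc; +-identityʳ)
open import Data.Product using (Σ; ∃; _×_; _,_; proj₁; proj₂)
open import Data.Sum using (_⊎_; inj₁; inj₂)
open import Data.Unit using (tt)
open import Function using (flip; _∘_)
open import Induction.WellFounded using (WellFounded; Acc; acc; module Subrelation)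
open import Relation.Binary.Construct.Closure.ReflexiveTransitive using (Star; ε; _◅_; _◅◅_)
open import Relation.Binary.Construct.Closure.Transitive as Plus
  using (TransClosure; [_]; _∷_; _∷ʳ_)
open import Relation.Binary.PropositionalEquality using (_≡_; _≢_; refl; sym; cong; subst)
open import Relation.Nullary using (¬_; Dec; yes; no)

wf-mono : ∀ {m n} A → m ≤ n → wf m A → wf n A
wf-mono (fvar X) m≤n w              = tt
wf-mono (bvar i) m≤n i<m            = <-≤-trans i<m m≤n
wf-mono (A ⇒ B)  m≤n (wA , wB)      = wf-mono A m≤n wA , wf-mono B m≤n wB
wf-mono (● A)    m≤n w              = wf-mono A m≤n w
wf-mono (μ A)    m≤n (w , proper-A) = wf-mono A (s≤s m≤n) w , proper-A

wf⇒proper : ∀ {n k} A → n ≤ k → wf n A → proper k A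
wf⇒proper (fvar X) n≤k w         = tt
wf⇒proper (bvar i) n≤k i<n       = <⇒≢ (<-≤-trans i<n n≤k)
wf⇒proper (A ⇒ B)  n≤k (wA , wB) = inj₁ (wf⇒proper A n≤k wA , wf⇒proper B n≤k wB)
wf⇒proper (● A)    n≤k w         = tt
wf⇒proper (μ A)    n≤k (w , _)   = inj₁ (wf⇒proper A (s≤s n≤k) w)

guardedAt⇒<length : ∀ bs i → guardedAt bs i → i < length bs
guardedAt⇒<length (b ∷ bs) zero    g = s≤s z≤n
guardedAt⇒<length (b ∷ bs) (suc i) g = s≤s (guardedAt⇒<length bs i g)

∈FTV-openAt : ∀ {X k U} A → X ∈FTV A → X ∈FTV openAt k U A
∈FTV-openAt (fvar Y) X≡Y        = X≡Y
∈FTV-openAt (A ⇒ B)  (inj₁ X∈A) = inj₁ (∈FTV-openAt A X∈A)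
∈FTV-openAt (A ⇒ B)  (inj₂ X∈B) = inj₂ (∈FTV-openAt B X∈B)
∈FTV-openAt (● A)    X∈A        = ∈FTV-openAt A X∈A
∈FTV-openAt (μ A)    X∈A        = ∈FTV-openAt A X∈A

guardedChain-openAt : ∀ {k U} bs A → length bs ≤ k →
  GuardedChain bs (tail A) → GuardedChain bs (tail (openAt k U A))
guardedChain-openAt bs (fvar X) len≤k ()
guardedChain-openAt {k} bs (bvar i) len≤k g with i ≟ k
... | yes refl = ⊥-elim (<⇒≢ (<-≤-trans (guardedAt⇒<length bs i g) len≤k) refl)
... | no _     = g
guardedChain-openAt bs (A ⇒ B) len≤k g = guardedChain-openAt bs B len≤k g
guardedChain-openAt bs (● A)   len≤k g =
  guardedChain-openAt (map (λ _ → true) bs) A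
    (subst (_≤ _) (sym (length-map (λ _ → true) bs)) len≤k) g
guardedChain-openAt bs (μ A)   len≤k g = guardedChain-openAt (false ∷ bs) A (s≤s len≤k) g

guardedChain-openAt⁻ : ∀ {k X} bs A →
  GuardedChain bs (tail (openAt k (fvar X) A)) → GuardedChain bs (tail A)
guardedChain-openAt⁻ bs (fvar Y) ()
guardedChain-openAt⁻ {k} bs (bvar i) g with i ≟ k
... | yes _ = ⊥-elim g
... | no _  = g
guardedChain-openAt⁻ bs (A ⇒ B) g = guardedChain-openAt⁻ bs B g
guardedChain-openAt⁻ bs (● A)   g = guardedChain-openAt⁻ (map (λ _ → true) bs) A g
guardedChain-openAt⁻ bs (μ A)   g = guardedChain-openAt⁻ (false ∷ bs) A g

topVariant-openAt : ∀ {k U} A → TopVariant A → TopVariant (openAt k U A)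
topVariant-openAt A = guardedChain-openAt [] A z≤n

proper-openAt : ∀ {j k U} A → j ≢ k → TypeExpr U → proper j A → proper j (openAt k U A)
proper-openAt (fvar X) j≢k U-wf pr = tt
proper-openAt {k = k} {U} (bvar i) j≢k U-wf pr with i ≟ k
... | yes _ = wf⇒proper U z≤n U-wf
... | no _  = pr
proper-openAt (A ⇒ B) j≢k U-wf (inj₁ (prA , prB)) =
  inj₁ (proper-openAt A j≢k U-wf prA , proper-openAt B j≢k U-wf prB)
proper-openAt (A ⇒ B) j≢k U-wf (inj₂ tv) = inj₂ (topVariant-openAt B tv)
proper-openAt (● A)   j≢k U-wf pr        = tt
proper-openAt (μ A)   j≢k U-wf (inj₁ pr) =
  inj₁ (proper-openAt A (j≢k ∘ suc-injective) U-wf pr)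
proper-openAt (μ A)   j≢k U-wf (inj₂ tv) = inj₂ (topVariant-openAt (μ A) tv)

proper-openAt⁻ : ∀ {j k X} A → j ≢ k → proper j (openAt k (fvar X) A) → proper j A
proper-openAt⁻ (fvar Y) j≢k pr = tt
proper-openAt⁻ {k = k} (bvar i) j≢k pr with i ≟ k
... | yes refl = λ i≡j → j≢k (sym i≡j)
... | no _     = pr
proper-openAt⁻ (A ⇒ B) j≢k (inj₁ (prA , prB)) =
  inj₁ (proper-openAt⁻ A j≢k prA , proper-openAt⁻ B j≢k prB)
proper-openAt⁻ (A ⇒ B) j≢k (inj₂ tv) = inj₂ (guardedChain-openAt⁻ [] B tv)
proper-openAt⁻ (● A)   j≢k pr        = tt
proper-openAt⁻ (μ A)   j≢k (inj₁ pr) = inj₁ (proper-openAt⁻ A (j≢k ∘ suc-injective) pr)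
proper-openAt⁻ (μ A)   j≢k (inj₂ tv) = inj₂ (guardedChain-openAt⁻ [] (μ A) tv)

wf-openAt : ∀ {k U} A → TypeExpr U → wf (suc k) A → wf k (openAt k U A)
wf-openAt (fvar X) U-wf w = tt
wf-openAt {k} {U} (bvar i) U-wf i<1+k with i ≟ k
... | yes _   = wf-mono U z≤n U-wf
... | no i≢k  = ≤∧≢⇒< (m<1+n⇒m≤n i<1+k) i≢k
wf-openAt (A ⇒ B) U-wf (wA , wB) = wf-openAt A U-wf wA , wf-openAt B U-wf wB
wf-openAt (● A)   U-wf w         = wf-openAt A U-wf w
wf-openAt (μ A)   U-wf (w , pr)  = wf-openAt A U-wf w , proper-openAt A (λ ()) U-wf pr

wf-openAt⁻ : ∀ {k X} A → wf k (openAt k (fvar X) A) → wf (suc k) A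
wf-openAt⁻ (fvar Y) w = tt
wf-openAt⁻ {k} (bvar i) w with i ≟ k
... | yes refl = ≤-refl
... | no _     = s≤s (<⇒≤ w)
wf-openAt⁻ (A ⇒ B) (wA , wB) = wf-openAt⁻ A wA , wf-openAt⁻ B wB
wf-openAt⁻ (● A)   w         = wf-openAt⁻ A w
wf-openAt⁻ (μ A)   (w , pr)  = wf-openAt⁻ A w , proper-openAt⁻ A (λ ()) pr

≃⇒TypeExpr : ∀ {A B} → A ≃ B → TypeExpr A × TypeExpr B
≃⇒TypeExpr (≃-refl A-wf)             = A-wf , A-wf
≃⇒TypeExpr (≃-sym A≃B)               = let (A-wf , B-wf) = ≃⇒TypeExpr A≃B in B-wf , A-wf
≃⇒TypeExpr (≃-trans A≃B B≃C)         = proj₁ (≃⇒TypeExpr A≃B) , proj₂ (≃⇒TypeExpr B≃C)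
≃⇒TypeExpr (≃-● A≃B)                 = ≃⇒TypeExpr A≃B
≃⇒TypeExpr (≃-⇒ A≃C B≃D)             =
  (proj₁ (≃⇒TypeExpr A≃C) , proj₁ (≃⇒TypeExpr B≃D)) ,
  (proj₂ (≃⇒TypeExpr A≃C) , proj₂ (≃⇒TypeExpr B≃D))
≃⇒TypeExpr (≃-⇒⊤ A-wf)               = (A-wf , s≤s z≤n , tt) , (s≤s z≤n , tt)
≃⇒TypeExpr (≃-unfold {A} μA-wf)      = μA-wf , wf-openAt A μA-wf (proj₁ μA-wf)
≃⇒TypeExpr (≃-fold A-wf μC-wf _)     = A-wf , μC-wf
≃⇒TypeExpr (≃-●⇒ A-wf B-wf)          = (A-wf , B-wf) , (A-wf , B-wf)

≼⇒TypeExpr : ∀ {γ A B} → γ ⊢ A ≼ B → TypeExpr A × TypeExpr B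
≼⇒TypeExpr (≼-set _ A≼B)       = ≼⇒TypeExpr A≼B
≼⇒TypeExpr (≼-hyp _ _)         = tt , tt
≼⇒TypeExpr (≼-⊤ _ A-wf)        = A-wf , (s≤s z≤n , tt)
≼⇒TypeExpr (≼-≃ _ A≃B)         = ≃⇒TypeExpr A≃B
≼⇒TypeExpr (≼-trans _ A≼B B≼C) = proj₁ (≼⇒TypeExpr A≼B) , proj₂ (≼⇒TypeExpr B≼C)
≼⇒TypeExpr (≼-● A≼B)           = ≼⇒TypeExpr A≼B
≼⇒TypeExpr (≼-⇒ _ A′≼A B≼B′)   =
  (proj₂ (≼⇒TypeExpr A′≼A) , proj₁ (≼⇒TypeExpr B≼B′)) ,
  (proj₁ (≼⇒TypeExpr A′≼A) , proj₂ (≼⇒TypeExpr B≼B′))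
≼⇒TypeExpr (≼-μ {A = A} {B} _ _ _ _ _ _ _ _ _ prA prB A≼B) =
  (wf-openAt⁻ A (proj₁ (≼⇒TypeExpr A≼B)) , prA) , (wf-openAt⁻ B (proj₂ (≼⇒TypeExpr A≼B)) , prB)
≼⇒TypeExpr (≼-next _ A-wf)     = A-wf , A-wf

openAll : ℕ → List Ty → Ty → Ty
openAll k []      A = A
openAll k (U ∷ σ) A = openAt k U (openAll (suc k) σ A)

openAll-fvar : ∀ k σ X → openAll k σ (fvar X) ≡ fvar X
openAll-fvar k []      X = refl
openAll-fvar k (U ∷ σ) X = cong (openAt k U) (openAll-fvar (suc k) σ X)

openAll-● : ∀ k σ A → openAll k σ (● A) ≡ ● (openAll k σ A)
openAll-● k []      A = refl
openAll-● k (U ∷ σ) A = cong (openAt k U) (openAll-● (suc k) σ A)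

openAll-⇒ : ∀ k σ A B → openAll k σ (A ⇒ B) ≡ (openAll k σ A ⇒ openAll k σ B)
openAll-⇒ k []      A B = refl
openAll-⇒ k (U ∷ σ) A B = cong (openAt k U) (openAll-⇒ (suc k) σ A B)

openAll-μ : ∀ k σ A → openAll k σ (μ A) ≡ μ (openAll (suc k) σ A)
openAll-μ k []      A = refl
openAll-μ k (U ∷ σ) A = cong (openAt k U) (openAll-μ (suc k) σ A)

wf-openAll : ∀ k σ A → All TypeExpr σ → wf (k + length σ) A → wf k (openAll k σ A)
wf-openAll k []      A []          w = subst (λ n → wf n A) (+-identityʳ k) w
wf-openAll k (U ∷ σ) A (U-wf ∷ σ-wf) w =
  wf-openAt (openAll (suc k) σ A) U-wf
    (wf-openAll (suc k) σ A σ-wf (subst (λ n → wf n A) (+-suc k (length σ)) w))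

topVariant-openAll : ∀ k σ A → TopVariant A → TopVariant (openAll k σ A)
topVariant-openAll k []      A tv = tv
topVariant-openAll k (U ∷ σ) A tv =
  topVariant-openAt (openAll (suc k) σ A) (topVariant-openAll (suc k) σ A tv)

guardedAt? : ∀ bs i → Dec (guardedAt bs i)
guardedAt? []           i       = no λ ()
guardedAt? (true ∷ bs)  zero    = yes refl
guardedAt? (false ∷ bs) zero    = no λ ()
guardedAt? (b ∷ bs)     (suc i) = guardedAt? bs i

guardedChain? : ∀ bs A → Dec (GuardedChain bs A)
guardedChain? bs (fvar X) = no λ ()
guardedChain? bs (bvar i) = guardedAt? bs i
guardedChain? bs (A ⇒ B)  = no λ ()
guardedChain? bs (● A)    = guardedChain? (map (λ _ → true) bs) A
guardedChain? bs (μ A)    = guardedChain? (false ∷ bs) A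

topVariant? : ∀ A → Dec (TopVariant A)
topVariant? A = guardedChain? [] (tail A)

module FrameProperties (𝓕 : Frame) where
  open Frame 𝓕

  infix 4 _▷⁺_ _▷*_

  _▷⁺_ : W → W → Set
  _▷⁺_ = TransClosure _▷_

  _▷*_ : W → W → Set
  _▷*_ = Star _▷_

  ▷⁺-reverse : ∀ {p q} → p ▷⁺ q → TransClosure (flip _▷_) q p
  ▷⁺-reverse [ p▷q ]      = [ p▷q ]
  ▷⁺-reverse (p▷q ∷ q▷⁺r) = ▷⁺-reverse q▷⁺r ∷ʳ p▷q

  ▷⁺-wellFounded : WellFounded (flip _▷⁺_)
  ▷⁺-wellFounded = Subrelation.wellFounded ▷⁺-reverse (Plus.wellFounded (flip _▷_) wf▷)

  Accessible : W → Set
  Accessible = Acc (flip _▷⁺_)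

  ▷◅*⇒▷⁺ : ∀ {p q r} → p ▷ q → q ▷* r → p ▷⁺ r
  ▷◅*⇒▷⁺ p▷q ε            = [ p▷q ]
  ▷◅*⇒▷⁺ p▷q (q▷s ◅ s▷*r) = p▷q ∷ ▷◅*⇒▷⁺ q▷s s▷*r

  ▷⁺⇒▷* : ∀ {p q} → p ▷⁺ q → p ▷* q
  ▷⁺⇒▷* [ p▷q ]      = p▷q ◅ ε
  ▷⁺⇒▷* (p▷q ∷ q▷⁺r) = p▷q ◅ ▷⁺⇒▷* q▷⁺r

  ▷*▷⇒first-step : ∀ {p q r} → p ▷* q → q ▷ r → ∃ λ s → p ▷ s × s ▷* r
  ▷*▷⇒first-step ε            q▷r = _ , q▷r , ε
  ▷*▷⇒first-step (p▷s ◅ s▷*q) q▷r = _ , p▷s , (s▷*q ◅◅ (q▷r ◅ ε))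

  ▷▷*⇒last-step : ∀ {p q r} → p ▷ q → q ▷* r → ∃ λ s → p ▷* s × s ▷ r
  ▷▷*⇒last-step p▷q ε = _ , ε , p▷q
  ▷▷*⇒last-step p▷q (q▷t ◅ t▷*r) =
    let (s , q▷*s , s▷r) = ▷▷*⇒last-step q▷t t▷*r in s , p▷q ◅ q▷*s , s▷r

module Interpretation (𝓐 : LambdaAlgebra) (𝓕 : Frame) where
  open LambdaAlgebra 𝓐 using (V; _·_)
  open Frame 𝓕
  open FrameProperties 𝓕
  open Semantics 𝓐 𝓕

  ⇔-refl : ∀ {P} → P ⇔ P
  ⇔-refl = (λ x → x) , (λ x → x)

  ⇔-sym : ∀ {P Q} → P ⇔ Q → Q ⇔ P
  ⇔-sym (to , from) = from , to

  ⇔-trans : ∀ {P Q R} → P ⇔ Q → Q ⇔ R → P ⇔ R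
  ⇔-trans (to , from) (to′ , from′) = to′ ∘ to , from ∘ from′

  ×-⇔ : ∀ {P P′ Q Q′} → P ⇔ P′ → Q ⇔ Q′ → (P × Q) ⇔ (P′ × Q′)
  ×-⇔ (to , from) (to′ , from′) = (λ (x , y) → to x , to′ y) , (λ (x , y) → from x , from′ y)

  →-⇔ : ∀ {P P′ Q Q′} → P ⇔ P′ → Q ⇔ Q′ → (P → Q) ⇔ (P′ → Q′)
  →-⇔ (to , from) (to′ , from′) = (λ f → to′ ∘ f ∘ from) , (λ f → from′ ∘ f ∘ to)

  Π-⇔ : ∀ {A : Set} {P Q : A → Set} → (∀ x → P x ⇔ Q x) → (∀ x → P x) ⇔ (∀ x → Q x)
  Π-⇔ P⇔Q = (λ f x → proj₁ (P⇔Q x) (f x)) , (λ f x → proj₂ (P⇔Q x) (f x))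

  Σ-⇔ : ∀ {A : Set} {P Q : A → Set} → (∀ x → P x ⇔ Q x) → Σ A P ⇔ Σ A Q
  Σ-⇔ P⇔Q = (λ (x , y) → x , proj₁ (P⇔Q x) y) , (λ (x , y) → x , proj₂ (P⇔Q x) y)

  Pred : Set₁
  Pred = W → V → Set

  ⊥ₑ : TyEnv
  ⊥ₑ _ _ _ = ⊥

  infixr 5 _∷ₑ_
  _∷ₑ_ : Pred → TyEnv → TyEnv
  (P ∷ₑ ρ) zero    = P
  (P ∷ₑ ρ) (suc i) = ρ i

  _[_↦_] : TyEnv → ℕ → Pred → TyEnv
  (ρ [ zero  ↦ P ]) zero    = P
  (ρ [ zero  ↦ P ]) (suc i) = ρ (suc i)
  (ρ [ suc k ↦ P ]) zero    = ρ zero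
  (ρ [ suc k ↦ P ]) (suc i) = ((ρ ∘ suc) [ k ↦ P ]) i

  [↦]-≡ : ∀ ρ k {P} → (ρ [ k ↦ P ]) k ≡ P
  [↦]-≡ ρ zero    = refl
  [↦]-≡ ρ (suc k) = [↦]-≡ (ρ ∘ suc) k

  [↦]-≢ : ∀ ρ {k P} i → i ≢ k → (ρ [ k ↦ P ]) i ≡ ρ i
  [↦]-≢ ρ {zero}  zero    i≢k = ⊥-elim (i≢k refl)
  [↦]-≢ ρ {zero}  (suc i) i≢k = refl
  [↦]-≢ ρ {suc k} zero    i≢k = refl
  [↦]-≢ ρ {suc k} (suc i) i≢k = [↦]-≢ (ρ ∘ suc) i (i≢k ∘ cong suc)

  ≡⇒⇔ : ∀ {P Q : Pred} → P ≡ Q → ∀ q u → P q u ⇔ Q q u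
  ≡⇒⇔ refl q u = ⇔-refl

  □⁺ : (W → Set) → W → Set
  □⁺ P p = ∀ {q} → p ▷⁺ q → P q

  □⁺-step : ∀ {P p q} → □⁺ P p → p ▷⁺ q → □⁺ P q
  □⁺-step □P p▷⁺q q▷⁺r = □P (p▷⁺q Plus.++ q▷⁺r)

  -- η interprets the free and ρ the bound type variables. At world p the variable
  -- bound by μ A denotes μ A at strictly later worlds only; the ⇒ clause treats p
  -- itself separately because accessibility proofs exist only for strict successors.
  mutual
    ⟦_⟧ : Ty → TyEnv → TyEnv → ∀ {p} → Accessible p → V → Set
    ⟦ fvar X ⟧ η ρ {p} a u = η X p u
    ⟦ bvar i ⟧ η ρ {p} a u = ρ i p u
    ⟦ A ⇒ B ⟧ η ρ {p} a@(acc rs) u =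
      (∀ v → ⟦ A ⟧ η ρ a v → ⟦ B ⟧ η ρ a (u · v)) ×
      (∀ q (h : p ▷⁺ q) v → ⟦ A ⟧ η ρ (rs h) v → ⟦ B ⟧ η ρ (rs h) (u · v))
    ⟦ ● A ⟧ η ρ {p} (acc rs) u = ∀ q (h : p ▷ q) → ⟦ A ⟧ η ρ (rs [ h ]) u
    ⟦ μ A ⟧ η ρ a u = ⟦ A ⟧ η (⟦μ A ⟧⁺ η ρ a ∷ₑ ρ) a u

    ⟦μ_⟧⁺ : Ty → TyEnv → TyEnv → ∀ {p} → Accessible p → Pred
    ⟦μ A ⟧⁺ η ρ {p} (acc rs) q v = Σ (p ▷⁺ q) λ h → ⟦ μ A ⟧ η ρ (rs h) v

  𝓘 : TyEnv → Ty → Pred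
  𝓘 η A p = ⟦ A ⟧ η ⊥ₑ (▷⁺-wellFounded p)

  ⟦⟧-guardedChain : ∀ {η ρ p} bs A → GuardedChain bs (tail A) →
    (∀ i → guardedAt bs i → ∀ u → ρ i p u) →
    □⁺ (λ q → ∀ i → i < length bs → ∀ u → ρ i q u) p →
    (a : Accessible p) → ∀ u → ⟦ A ⟧ η ρ a u
  ⟦⟧-guardedChain bs (fvar X) () now later a u
  ⟦⟧-guardedChain bs (bvar i) g  now later a u = now i g u
  ⟦⟧-guardedChain bs (A ⇒ B) g now later (acc rs) u =
    (λ v _ → ⟦⟧-guardedChain bs B g now later (acc rs) (u · v)) ,
    (λ q h v _ → ⟦⟧-guardedChain bs B g (λ i g′ → later h i (guardedAt⇒<length bs i g′))
                   (□⁺-step later h) (rs h) (u · v))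
  ⟦⟧-guardedChain bs (● A) g now later (acc rs) u q h =
    ⟦⟧-guardedChain bs● A g (λ i g′ → later [ h ] i (<length-bs● (guardedAt⇒<length bs● i g′)))
      (λ h′ i i< → later (h ∷ h′) i (<length-bs● i<)) (rs [ h ]) u
    where
    bs● = map (λ _ → true) bs
    <length-bs● : ∀ {i} → i < length bs● → i < length bs
    <length-bs● = subst (_ <_) (length-map (λ _ → true) bs)
  ⟦⟧-guardedChain {η} {ρ} bs (μ A) g now later a@(acc rs) u =
    ⟦⟧-guardedChain (false ∷ bs) A g now′ later′ a u
    where
    now′ : ∀ i → guardedAt (false ∷ bs) i → ∀ u → (⟦μ A ⟧⁺ η ρ a ∷ₑ ρ) i _ u
    now′ zero    ()
    now′ (suc i) = now i
    later′ : □⁺ (λ q → ∀ i → i < suc (length bs) → ∀ u → (⟦μ A ⟧⁺ η ρ a ∷ₑ ρ) i q u) _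
    later′ h zero    _         v =
      h , ⟦⟧-guardedChain bs (μ A) g (λ i g′ → later h i (guardedAt⇒<length bs i g′))
            (□⁺-step later h) (rs h) v
    later′ h (suc i) (s≤s i<) = later h i i<

  ⟦⟧-topVariant : ∀ {η ρ p} A → TopVariant A → (a : Accessible p) → ∀ u → ⟦ A ⟧ η ρ a u
  ⟦⟧-topVariant A tv = ⟦⟧-guardedChain [] A tv (λ _ ()) (λ _ _ ())


  AgreeOn : Ty → TyEnv → TyEnv → Set
  AgreeOn A η η′ = ∀ X → X ∈FTV A → ∀ q u → η X q u ⇔ η′ X q u

  agreeOn-refl : ∀ A {η} → AgreeOn A η η
  agreeOn-refl A _ _ _ _ = ⇔-refl

  AgreeBelow : ℕ → TyEnv → TyEnv → W → Set
  AgreeBelow n ρ ρ′ q = ∀ i → i < n → ∀ u → ρ i q u ⇔ ρ′ i q u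

  AgreeBelowExcept : ℕ → ℕ → TyEnv → TyEnv → W → Set
  AgreeBelowExcept n k ρ ρ′ q = ∀ i → i < n → i ≢ k → ∀ u → ρ i q u ⇔ ρ′ i q u

  ∷ₑ-agreeBelow : ∀ {n P P′ ρ ρ′ q} → (∀ v → P q v ⇔ P′ q v) →
    AgreeBelow n ρ ρ′ q → AgreeBelow (suc n) (P ∷ₑ ρ) (P′ ∷ₑ ρ′) q
  ∷ₑ-agreeBelow P≈ ρ≈ zero    _        = P≈
  ∷ₑ-agreeBelow P≈ ρ≈ (suc i) (s≤s i<) = ρ≈ i i<

  ∷ₑ-agreeBelowExcept : ∀ {n k P P′ ρ ρ′ q} → (∀ v → P q v ⇔ P′ q v) →
    AgreeBelowExcept n k ρ ρ′ q → AgreeBelowExcept (suc n) (suc k) (P ∷ₑ ρ) (P′ ∷ₑ ρ′) q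
  ∷ₑ-agreeBelowExcept P≈ ρ≈ zero    _        _   = P≈
  ∷ₑ-agreeBelowExcept P≈ ρ≈ (suc i) (s≤s i<) i≢k = ρ≈ i i< (i≢k ∘ cong suc)

  -- Properness of A in k lets ρ and ρ′ disagree on k at p itself.
  mutual
    ⟦⟧-local : ∀ {η η′ ρ ρ′ n k p} A (a a′ : Accessible p) → wf n A → proper k A →
      AgreeOn A η η′ → □⁺ (AgreeBelow n ρ ρ′) p → AgreeBelowExcept n k ρ ρ′ p →
      ∀ u → ⟦ A ⟧ η ρ a u ⇔ ⟦ A ⟧ η′ ρ′ a′ u
    ⟦⟧-local (fvar X) a a′ w pr η≈ ρ≈⁺ ρ≈ u = η≈ X refl _ u
    ⟦⟧-local (bvar i) a a′ w pr η≈ ρ≈⁺ ρ≈ u = ρ≈ i w pr u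
    ⟦⟧-local (A ⇒ B) a a′ w (inj₂ tv) η≈ ρ≈⁺ ρ≈ u =
      (λ _ → ⟦⟧-topVariant (A ⇒ B) tv a′ u) , (λ _ → ⟦⟧-topVariant (A ⇒ B) tv a u)
    ⟦⟧-local (A ⇒ B) a@(acc rs) a′@(acc rs′) (wA , wB) (inj₁ (prA , prB)) η≈ ρ≈⁺ ρ≈ u =
      ×-⇔ (Π-⇔ λ v → →-⇔ (⟦⟧-local A a a′ wA prA η≈A ρ≈⁺ ρ≈ v)
                          (⟦⟧-local B a a′ wB prB η≈B ρ≈⁺ ρ≈ (u · v)))
          (Π-⇔ λ q → Π-⇔ λ h → Π-⇔ λ v →
             →-⇔ (⟦⟧-local-later A (rs h) (rs′ h) wA η≈A ρ≈⁺ h v)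
                 (⟦⟧-local-later B (rs h) (rs′ h) wB η≈B ρ≈⁺ h (u · v)))
      where
      η≈A : AgreeOn A _ _
      η≈A X = η≈ X ∘ inj₁
      η≈B : AgreeOn B _ _
      η≈B X = η≈ X ∘ inj₂
    ⟦⟧-local (● A) (acc rs) (acc rs′) w pr η≈ ρ≈⁺ ρ≈ u =
      Π-⇔ λ q → Π-⇔ λ h → ⟦⟧-local-later A (rs [ h ]) (rs′ [ h ]) w η≈ ρ≈⁺ [ h ] u
    ⟦⟧-local (μ A) a a′ w (inj₂ tv) η≈ ρ≈⁺ ρ≈ u =
      (λ _ → ⟦⟧-topVariant (μ A) tv a′ u) , (λ _ → ⟦⟧-topVariant (μ A) tv a u)
    ⟦⟧-local {η} {η′} {ρ} {ρ′} (μ A) a@(acc rs) a′@(acc rs′) (w , pr₀) (inj₁ pr) η≈ ρ≈⁺ ρ≈ u =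
      ⟦⟧-local A a a′ w pr η≈ (λ h → ∷ₑ-agreeBelow (μ⁺≈ _) (ρ≈⁺ h))
        (∷ₑ-agreeBelowExcept (μ⁺≈ _) ρ≈) u
      where
      μ⁺≈ : ∀ q v → ⟦μ A ⟧⁺ η ρ a q v ⇔ ⟦μ A ⟧⁺ η′ ρ′ a′ q v
      μ⁺≈ q v = Σ-⇔ λ h → ⟦⟧-local-later (μ A) (rs h) (rs′ h) (w , pr₀) η≈ ρ≈⁺ h v

    ⟦⟧-local-later : ∀ {η η′ ρ ρ′ n p q} A (b b′ : Accessible q) → wf n A →
      AgreeOn A η η′ → □⁺ (AgreeBelow n ρ ρ′) p → p ▷⁺ q →
      ∀ u → ⟦ A ⟧ η ρ b u ⇔ ⟦ A ⟧ η′ ρ′ b′ u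
    ⟦⟧-local-later A b b′ w η≈ ρ≈⁺ h =
      ⟦⟧-local A b b′ w (wf⇒proper A ≤-refl w) η≈ (□⁺-step ρ≈⁺ h) (λ i i< _ → ρ≈⁺ h i i<)

  ⟦⟧-acc-irrelevant : ∀ {η ρ n p} A (a a′ : Accessible p) → wf n A →
    ∀ u → ⟦ A ⟧ η ρ a u ⇔ ⟦ A ⟧ η ρ a′ u
  ⟦⟧-acc-irrelevant A a a′ w =
    ⟦⟧-local A a a′ w (wf⇒proper A ≤-refl w) (agreeOn-refl A)
      (λ _ _ _ _ → ⇔-refl) (λ _ _ _ _ → ⇔-refl)

  ⟦⟧-closed : ∀ {η ρ ρ′ p} U (a a′ : Accessible p) → TypeExpr U →
    ∀ u → ⟦ U ⟧ η ρ a u ⇔ ⟦ U ⟧ η ρ′ a′ u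
  ⟦⟧-closed U a a′ U-wf =
    ⟦⟧-local {k = 0} U a a′ U-wf (wf⇒proper U z≤n U-wf) (agreeOn-refl U) (λ _ _ ()) (λ _ ())

  ⟦⟧-body-cong : ∀ {η η′ ρ ρ′ p} A (a : Accessible p) → wf 1 A → proper 0 A → AgreeOn A η η′ →
    □⁺ (λ q → ∀ v → ρ 0 q v ⇔ ρ′ 0 q v) p → ∀ u → ⟦ A ⟧ η ρ a u ⇔ ⟦ A ⟧ η′ ρ′ a u
  ⟦⟧-body-cong A a w pr η≈ ρ₀≈ =
    ⟦⟧-local A a a w pr η≈ (λ { h zero _ → ρ₀≈ h ; h (suc i) (s≤s ()) })
      (λ { zero _ 0≢0 → ⊥-elim (0≢0 refl) ; (suc i) (s≤s ()) })

  ⟦⟧-openAt : ∀ {η U n k ρ p} A → TypeExpr U → wf n A → (a a′ : Accessible p) →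
    ∀ u → ⟦ openAt k U A ⟧ η ρ a u ⇔ ⟦ A ⟧ η (ρ [ k ↦ 𝓘 η U ]) a′ u
  ⟦⟧-openAt (fvar X) U-wf w a a′ u = ⇔-refl
  ⟦⟧-openAt {η} {U} {k = k} {ρ} {p} (bvar i) U-wf w a a′ u with i ≟ k
  ... | yes refl = ⇔-trans (⟦⟧-closed U a (▷⁺-wellFounded p) U-wf u) (⇔-sym (≡⇒⇔ ([↦]-≡ ρ i) p u))
  ... | no i≢k   = ⇔-sym (≡⇒⇔ ([↦]-≢ ρ i i≢k) p u)
  ⟦⟧-openAt (A ⇒ B) U-wf (wA , wB) a@(acc rs) a′@(acc rs′) u =
    ×-⇔ (Π-⇔ λ v → →-⇔ (⟦⟧-openAt A U-wf wA a a′ v) (⟦⟧-openAt B U-wf wB a a′ (u · v)))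
        (Π-⇔ λ q → Π-⇔ λ h → Π-⇔ λ v →
           →-⇔ (⟦⟧-openAt A U-wf wA (rs h) (rs′ h) v) (⟦⟧-openAt B U-wf wB (rs h) (rs′ h) (u · v)))
  ⟦⟧-openAt (● A) U-wf w (acc rs) (acc rs′) u =
    Π-⇔ λ q → Π-⇔ λ h → ⟦⟧-openAt A U-wf w (rs [ h ]) (rs′ [ h ]) u
  ⟦⟧-openAt {η} {U} {n} {k} {ρ} (μ A) U-wf (w , pr) a@(acc rs) a′@(acc rs′) u =
    ⇔-trans (⟦⟧-openAt A U-wf w a a′ u)
      (⟦⟧-local A a′ a′ w (wf⇒proper A ≤-refl w) (agreeOn-refl A)
        (λ _ → agree _) (λ i i< _ → agree _ i i<) u)
    where
    agree : ∀ q → AgreeBelow (suc n) ((⟦μ openAt (suc k) U A ⟧⁺ η ρ a ∷ₑ ρ) [ suc k ↦ 𝓘 η U ])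
                                     (⟦μ A ⟧⁺ η (ρ [ k ↦ 𝓘 η U ]) a′ ∷ₑ (ρ [ k ↦ 𝓘 η U ])) q
    agree q zero    _ v = Σ-⇔ λ h → ⟦⟧-openAt (μ A) U-wf (w , pr) (rs h) (rs′ h) v
    agree q (suc i) _ v = ⇔-refl

  ⟦μ⟧⁺-▷⁺ : ∀ {η ρ n p q} A (a : Accessible p) → wf n (μ A) → p ▷⁺ q → (b : Accessible q) →
    ∀ v → ⟦μ A ⟧⁺ η ρ a q v ⇔ ⟦ μ A ⟧ η ρ b v
  ⟦μ⟧⁺-▷⁺ A (acc rs) w h b v =
    (λ (h′ , x) → proj₁ (⟦⟧-acc-irrelevant (μ A) (rs h′) b w v) x) ,
    (λ x → h , proj₂ (⟦⟧-acc-irrelevant (μ A) (rs h) b w v) x)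

  ▷*-split : ∀ {p} {P : W → Set} → (∀ q → p ▷* q → P q) ⇔ (P p × (∀ q → p ▷⁺ q → P q))
  ▷*-split {p} {P} = (λ f → f p ε , λ q → f q ∘ ▷⁺⇒▷*) , from
    where
    from : P p × (∀ q → p ▷⁺ q → P q) → ∀ q → p ▷* q → P q
    from (now , later) q ε             = now
    from (now , later) q (p▷r ◅ r▷*q) = later q (▷◅*⇒▷⁺ p▷r r▷*q)

  𝓘-top : ∀ {η} A → TopVariant A → ∀ p u → 𝓘 η A p u
  𝓘-top A tv p = ⟦⟧-topVariant A tv (▷⁺-wellFounded p)

  𝓘-● : ∀ {η n p} A → wf n A → ∀ u → 𝓘 η (● A) p u ⇔ (∀ q → p ▷ q → 𝓘 η A q u)
  𝓘-● A w u = Π-⇔ λ q → Π-⇔ λ h → ⟦⟧-acc-irrelevant A _ _ w u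

  𝓘-⇒ : ∀ {η n p} A B → wf n A → wf n B → ∀ u →
    𝓘 η (A ⇒ B) p u ⇔ (∀ q → p ▷* q → ∀ v → 𝓘 η A q v → 𝓘 η B q (u · v))
  𝓘-⇒ A B wA wB u =
    ⇔-trans (×-⇔ ⇔-refl (Π-⇔ λ q → Π-⇔ λ h → Π-⇔ λ v →
                           →-⇔ (⟦⟧-acc-irrelevant A _ _ wA v) (⟦⟧-acc-irrelevant B _ _ wB (u · v))))
            (⇔-sym ▷*-split)

  𝓘-μ : ∀ {η p} A → TypeExpr (μ A) → ∀ u → 𝓘 η (μ A) p u ⇔ 𝓘 η (open′ A (μ A)) p u
  𝓘-μ {η} {p} A μA-wf@(w , pr) u =
    ⇔-trans (⟦⟧-body-cong A a w pr (agreeOn-refl A) (λ h → ⟦μ⟧⁺-▷⁺ A a μA-wf h _) u)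
            (⇔-sym (⟦⟧-openAt A μA-wf w a a u))
    where a = ▷⁺-wellFounded p

  𝓘-openAt-cong : ∀ {η η′ U U′ p} A → wf 1 A → proper 0 A → AgreeOn A η η′ →
    TypeExpr U → TypeExpr U′ → □⁺ (λ q → ∀ v → 𝓘 η U q v ⇔ 𝓘 η′ U′ q v) p →
    ∀ u → 𝓘 η (open′ A U) p u ⇔ 𝓘 η′ (open′ A U′) p u
  𝓘-openAt-cong {p = p} A w pr η≈ U-wf U′-wf U≈ u =
    ⇔-trans (⟦⟧-openAt A U-wf w a a u)
   (⇔-trans (⟦⟧-body-cong A a w pr η≈ U≈ u)
            (⇔-sym (⟦⟧-openAt A U′-wf w a a u)))
    where a = ▷⁺-wellFounded p

  ⟦⟧-hereditary : ∀ {η ρ n p q} → Hereditary η → Hereditary ρ → ∀ A → wf n A →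
    (a : Accessible p) (b : Accessible q) → p ▷ q → ∀ u → ⟦ A ⟧ η ρ a u → ⟦ A ⟧ η ρ b u
  ⟦⟧-hereditary η-her ρ-her (fvar X) w a b p▷q u x = η-her X p▷q u x
  ⟦⟧-hereditary η-her ρ-her (bvar i) w a b p▷q u x = ρ-her i p▷q u x
  ⟦⟧-hereditary {q = q} η-her ρ-her (A ⇒ B) (wA , wB) (acc rs) (acc rs′) p▷q u (_ , later) =
    (λ v y → ⟦⟧-acc-irrelevant B _ _ wB (u · v) .proj₁
               (later q [ p▷q ] v (⟦⟧-acc-irrelevant A _ _ wA v .proj₁ y))) ,
    (λ r h v y → ⟦⟧-acc-irrelevant B _ _ wB (u · v) .proj₁
                   (later r (p▷q ∷ h) v (⟦⟧-acc-irrelevant A _ _ wA v .proj₁ y)))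
  ⟦⟧-hereditary {q = q} η-her ρ-her (● A) w (acc rs) (acc rs′) p▷q u x r q▷r =
    ⟦⟧-hereditary η-her ρ-her A w (rs [ p▷q ]) (rs′ [ q▷r ]) q▷r u (x q p▷q)
  ⟦⟧-hereditary {η} {ρ} η-her ρ-her (μ A) (w , pr) a@(acc rs) b@(acc rs′) p▷q u x =
    ⟦⟧-local A b b w pr (agreeOn-refl A) (λ h → agree h)
      (λ { zero _ 0≢0 → ⊥-elim (0≢0 refl) ; (suc i) _ _ _ → ⇔-refl }) u .proj₁
      (⟦⟧-hereditary η-her μ⁺-her A w a b p▷q u x)
    where
    μ⁺-her : Hereditary (⟦μ A ⟧⁺ η ρ a ∷ₑ ρ)
    μ⁺-her zero    r▷s v (h , y) =
      h ∷ʳ r▷s , ⟦⟧-hereditary η-her ρ-her (μ A) (w , pr) (rs h) _ r▷s v y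
    μ⁺-her (suc i) = ρ-her i
    agree : ∀ {r} → _ ▷⁺ r → AgreeBelow (suc _) (⟦μ A ⟧⁺ η ρ a ∷ₑ ρ) (⟦μ A ⟧⁺ η ρ b ∷ₑ ρ) r
    agree h zero    _ v = ⇔-trans (⟦μ⟧⁺-▷⁺ A a (w , pr) (p▷q ∷ h) (rs′ h) v)
                                  (⇔-sym (⟦μ⟧⁺-▷⁺ A b (w , pr) h (rs′ h) v))
    agree h (suc i) _ v = ⇔-refl

  𝓘-hereditary : ∀ {η n p q} → Hereditary η → ∀ A → wf n A → p ▷ q → ∀ u → 𝓘 η A p u → 𝓘 η A q u
  𝓘-hereditary η-her A w = ⟦⟧-hereditary η-her (λ _ _ _ ()) A w _ _

  𝓘-hereditary* : ∀ {η n p q} → Hereditary η → ∀ A → wf n A → p ▷* q → ∀ u → 𝓘 η A p u → 𝓘 η A q u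
  𝓘-hereditary* η-her A w ε            u = λ x → x
  𝓘-hereditary* η-her A w (p▷r ◅ r▷*q) u =
    𝓘-hereditary* η-her A w r▷*q u ∘ 𝓘-hereditary η-her A w p▷r u

  𝓘-isInterpretation : ∀ η → IsInterpretation η (𝓘 η)
  𝓘-isInterpretation η = record
    { I-top = λ {A} _ tv → 𝓘-top A tv
    ; I-var = λ X _ p u → ⇔-refl
    ; I-●   = λ {A} A-wf _ p u → 𝓘-● A A-wf u
    ; I-⇒   = λ {A} {B} (A-wf , B-wf) _ p u → 𝓘-⇒ A B A-wf B-wf u
    ; I-μ   = λ {A} μA-wf _ p u → 𝓘-μ A μA-wf u
    }

  module Uniqueness {η I I′} (isI : IsInterpretation η I) (isI′ : IsInterpretation η I′) where
    private
      module I  = IsInterpretation isI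
      module I′ = IsInterpretation isI′

    Agree : Ty → W → Set
    Agree T p = ∀ u → I T p u ⇔ I′ T p u

    -- At a fixed world the induction is on the μ-body A, whose bound variables
    -- are instantiated by σ; properness rules out a bare bound variable.
    mutual
      agree-openAll : ∀ {p} → Accessible p → ∀ σ → All TypeExpr σ → ∀ A → wf (length σ) A →
        (∀ i → i < length σ → proper i A) → Agree (openAll 0 σ A) p
      agree-openAll {p} a σ σ-wf A w pr with topVariant? (openAll 0 σ A)
      ... | yes tv  = λ u → (λ _ → I′.I-top T-wf tv p u) , (λ _ → I.I-top T-wf tv p u)
        where T-wf = wf-openAll 0 σ A σ-wf w
      ... | no ¬tv = agree-nonTop a σ σ-wf A w pr ¬tv

      agree-later : ∀ {p} → Accessible p → ∀ T → TypeExpr T → □⁺ (Agree T) p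
      agree-later (acc rs) T T-wf h = agree-openAll (rs h) [] [] T T-wf (λ _ ())

      agree-nonTop : ∀ {p} → Accessible p → ∀ σ → All TypeExpr σ → ∀ A → wf (length σ) A →
        (∀ i → i < length σ → proper i A) → ¬ TopVariant (openAll 0 σ A) → Agree (openAll 0 σ A) p
      agree-nonTop {p} a σ σ-wf (fvar X) w pr ¬tv rewrite openAll-fvar 0 σ X =
        λ u → ⇔-trans (I.I-var X ¬tv p u) (⇔-sym (I′.I-var X ¬tv p u))
      agree-nonTop a σ σ-wf (bvar i) w pr ¬tv = ⊥-elim (pr i w refl)
      agree-nonTop {p} a σ σ-wf (● A) w pr ¬tv rewrite openAll-● 0 σ A =
        λ u → ⇔-trans (I.I-● A′-wf ¬tv p u)
             (⇔-trans (Π-⇔ λ q → Π-⇔ λ h → agree-later a _ A′-wf [ h ] u)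
                      (⇔-sym (I′.I-● A′-wf ¬tv p u)))
        where A′-wf = wf-openAll 0 σ A σ-wf w
      agree-nonTop {p} a σ σ-wf (A ⇒ B) (wA , wB) pr ¬tv rewrite openAll-⇒ 0 σ A B =
        λ u → ⇔-trans (I.I-⇒ (A′-wf , B′-wf) ¬tv p u)
             (⇔-trans (Π-⇔ λ q → Π-⇔ λ p▷*q → Π-⇔ λ v →
                         →-⇔ (agree-A q p▷*q v) (agree-B q p▷*q (u · v)))
                      (⇔-sym (I′.I-⇒ (A′-wf , B′-wf) ¬tv p u)))
        where
        A′-wf = wf-openAll 0 σ A σ-wf wA
        B′-wf = wf-openAll 0 σ B σ-wf wB
        pr-A×B : ∀ i → i < length σ → proper i A × proper i B
        pr-A×B i i< with pr i i<
        ... | inj₁ prs = prs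
        ... | inj₂ tv  = ⊥-elim (¬tv (topVariant-openAll 0 σ B tv))
        agree-A : ∀ q → p ▷* q → Agree (openAll 0 σ A) q
        agree-A q ε         = agree-openAll a σ σ-wf A wA (λ i → proj₁ ∘ pr-A×B i)
        agree-A q (t ◅ ts)  = agree-later a _ A′-wf (▷◅*⇒▷⁺ t ts)
        agree-B : ∀ q → p ▷* q → Agree (openAll 0 σ B) q
        agree-B q ε         = agree-openAll a σ σ-wf B wB (λ i → proj₂ ∘ pr-A×B i)
        agree-B q (t ◅ ts)  = agree-later a _ B′-wf (▷◅*⇒▷⁺ t ts)
      agree-nonTop {p} a σ σ-wf (μ A) (w , pr₀) pr ¬tv rewrite openAll-μ 0 σ A =
        λ u → ⇔-trans (I.I-μ μA′-wf ¬tv p u)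
             (⇔-trans (agree-openAll a (μ (openAll 1 σ A) ∷ σ) (μA′-wf ∷ σ-wf) A w pr′ u)
                      (⇔-sym (I′.I-μ μA′-wf ¬tv p u)))
        where
        μA′-wf : TypeExpr (μ (openAll 1 σ A))
        μA′-wf = subst TypeExpr (openAll-μ 0 σ A) (wf-openAll 0 σ (μ A) σ-wf (w , pr₀))
        pr′ : ∀ i → i < suc (length σ) → proper i A
        pr′ zero    _ = pr₀
        pr′ (suc i) (s≤s i<) with pr i i<
        ... | inj₁ prA = prA
        ... | inj₂ tv  =
          ⊥-elim (¬tv (subst TopVariant (openAll-μ 0 σ A) (topVariant-openAll 0 σ (μ A) tv)))

    interpretation-unique : ∀ A → TypeExpr A → ∀ p → Agree A p
    interpretation-unique A A-wf p = agree-openAll (▷⁺-wellFounded p) [] [] A A-wf (λ _ ())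

  𝓘-fold : ∀ {η A C} → TypeExpr A → TypeExpr (μ C) →
    (∀ p u → 𝓘 η A p u ⇔ 𝓘 η (open′ C A) p u) → ∀ p u → 𝓘 η A p u ⇔ 𝓘 η (μ C) p u
  𝓘-fold {η} {A} {C} A-wf μC-wf@(w , pr) A≈CA p = go (▷⁺-wellFounded p)
    where
    go : ∀ {p} → Accessible p → ∀ u → 𝓘 η A p u ⇔ 𝓘 η (μ C) p u
    go {p} (acc rs) u =
      ⇔-trans (A≈CA p u)
     (⇔-trans (𝓘-openAt-cong C w pr (agreeOn-refl C) A-wf μC-wf (λ h → go (rs h)) u)
              (⇔-sym (𝓘-μ C μC-wf u)))

  𝓘-●⇒ : ∀ {η A B} → Hereditary η → TypeExpr A → TypeExpr B →
    ∀ p u → 𝓘 η (● (A ⇒ B)) p u ⇔ 𝓘 η (● A ⇒ ● B) p u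
  𝓘-●⇒ {η} {A} {B} η-her A-wf B-wf p u = to , from
    where
    to : 𝓘 η (● (A ⇒ B)) p u → 𝓘 η (● A ⇒ ● B) p u
    to x = 𝓘-⇒ (● A) (● B) A-wf B-wf u .proj₂ λ q p▷*q v y → 𝓘-● B B-wf (u · v) .proj₂ λ s q▷s →
      let (r , p▷r , r▷*s) = ▷*▷⇒first-step p▷*q q▷s
      in 𝓘-⇒ A B A-wf B-wf u .proj₁ (𝓘-● (A ⇒ B) (A-wf , B-wf) u .proj₁ x r p▷r) s r▷*s v
           (𝓘-● A A-wf v .proj₁ y s q▷s)
    -- By local linearity every successor of t lies beyond r, so v ∈ A at r gives v ∈ ● A at t.
    from : 𝓘 η (● A ⇒ ● B) p u → 𝓘 η (● (A ⇒ B)) p u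
    from x = 𝓘-● (A ⇒ B) (A-wf , B-wf) u .proj₂ λ q p▷q → 𝓘-⇒ A B A-wf B-wf u .proj₂ λ r q▷*r v y →
      let (s , p▷*s , s▷r)          = ▷▷*⇒last-step p▷q q▷*r
          (t , s▷*t , t▷r , after-r) = locLin s▷r
          y● = 𝓘-● A A-wf v .proj₂ λ t′ t▷t′ → 𝓘-hereditary* η-her A A-wf (after-r t′ t▷t′) v y
      in 𝓘-● B B-wf (u · v) .proj₁
           (𝓘-⇒ (● A) (● B) A-wf B-wf u .proj₁ x t (p▷*s ◅◅ s▷*t) v y●) r t▷r

  𝓘-≃ : ∀ {η A B} → Hereditary η → A ≃ B → ∀ p u → 𝓘 η A p u ⇔ 𝓘 η B p u
  𝓘-≃ η-her (≃-refl _)          p u = ⇔-refl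
  𝓘-≃ η-her (≃-sym A≃B)         p u = ⇔-sym (𝓘-≃ η-her A≃B p u)
  𝓘-≃ η-her (≃-trans A≃B B≃C)   p u = ⇔-trans (𝓘-≃ η-her A≃B p u) (𝓘-≃ η-her B≃C p u)
  𝓘-≃ η-her (≃-● {A} {B} A≃B)   p u =
    let (A-wf , B-wf) = ≃⇒TypeExpr A≃B in
    ⇔-trans (𝓘-● A A-wf u) (⇔-trans (Π-⇔ λ q → Π-⇔ λ _ → 𝓘-≃ η-her A≃B q u) (⇔-sym (𝓘-● B B-wf u)))
  𝓘-≃ η-her (≃-⇒ {A} {B} {C} {D} A≃C B≃D) p u =
    let (A-wf , C-wf) = ≃⇒TypeExpr A≃C
        (B-wf , D-wf) = ≃⇒TypeExpr B≃D
    in ⇔-trans (𝓘-⇒ A B A-wf B-wf u)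
      (⇔-trans (Π-⇔ λ q → Π-⇔ λ _ → Π-⇔ λ v → →-⇔ (𝓘-≃ η-her A≃C q v) (𝓘-≃ η-her B≃D q (u · v)))
               (⇔-sym (𝓘-⇒ C D C-wf D-wf u)))
  𝓘-≃ η-her (≃-⇒⊤ {A} _)        p u = (λ _ → 𝓘-top ⊤ᵗ refl p u) , (λ _ → 𝓘-top (A ⇒ ⊤ᵗ) refl p u)
  𝓘-≃ η-her (≃-unfold {A} μA-wf) p u = 𝓘-μ A μA-wf u
  𝓘-≃ η-her (≃-fold A-wf μC-wf A≃CA) = 𝓘-fold A-wf μC-wf (𝓘-≃ η-her A≃CA)
  𝓘-≃ η-her (≃-●⇒ A-wf B-wf)     = 𝓘-●⇒ η-her A-wf B-wf

  [↦]-hereditary : ∀ {ρ P} k → Hereditary ρ → (∀ {p q} → p ▷ q → ∀ u → P p u → P q u) →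
    Hereditary (ρ [ k ↦ P ])
  [↦]-hereditary zero    ρ-her P-her zero    = P-her
  [↦]-hereditary zero    ρ-her P-her (suc i) = ρ-her (suc i)
  [↦]-hereditary (suc k) ρ-her P-her zero    = ρ-her zero
  [↦]-hereditary (suc k) ρ-her P-her (suc i) = [↦]-hereditary k (ρ-her ∘ suc) P-her i

  ⊨-++ˡ : ∀ {η} γ₁ {γ₂} → η ⊨ (γ₁ ++ γ₂) → η ⊨ γ₁
  ⊨-++ˡ γ₁ η⊨ = η⊨ ∘ ∈-++⁺ˡ

  ⊨-++ʳ : ∀ {η} γ₁ {γ₂} → η ⊨ (γ₁ ++ γ₂) → η ⊨ γ₂
  ⊨-++ʳ γ₁ η⊨ = η⊨ ∘ ∈-++⁺ʳ γ₁

  module μ-Rule {η : TyEnv} {A B : Ty} {X Y : ℕ} (η-her : Hereditary η) (X≢Y : X ≢ Y)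
                (μA-wf : TypeExpr (μ A)) (μB-wf : TypeExpr (μ B)) where

    η′ : TyEnv
    η′ = (η [ X ↦ 𝓘 η (μ A) ]) [ Y ↦ (λ q v → 𝓘 η (μ A) q v ⊎ 𝓘 η (μ B) q v) ]

    η′-X : ∀ q v → η′ X q v ⇔ 𝓘 η (μ A) q v
    η′-X q v = ⇔-trans (≡⇒⇔ ([↦]-≢ _ X X≢Y) q v) (≡⇒⇔ ([↦]-≡ η X) q v)

    η′-Y : ∀ q v → η′ Y q v ⇔ (𝓘 η (μ A) q v ⊎ 𝓘 η (μ B) q v)
    η′-Y = ≡⇒⇔ ([↦]-≡ _ Y)

    η′-other : ∀ Z → Z ≢ X → Z ≢ Y → ∀ q v → η′ Z q v ⇔ η Z q v
    η′-other Z Z≢X Z≢Y q v = ⇔-trans (≡⇒⇔ ([↦]-≢ _ Z Z≢Y) q v) (≡⇒⇔ ([↦]-≢ η Z Z≢X) q v)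

    η′-hereditary : Hereditary η′
    η′-hereditary =
      [↦]-hereditary Y ([↦]-hereditary X η-her (𝓘-hereditary η-her (μ A) μA-wf))
        λ { p▷q v (inj₁ x) → inj₁ (𝓘-hereditary η-her (μ A) μA-wf p▷q v x)
          ; p▷q v (inj₂ y) → inj₂ (𝓘-hereditary η-her (μ B) μB-wf p▷q v y) }

    η′⊨ : ∀ {γ} → ¬ X ∈FTVₐ γ → ¬ Y ∈FTVₐ γ → η ⊨ γ → η′ ⊨ ((X , Y) ∷ γ)
    η′⊨ X∉γ Y∉γ η⊨γ (here refl) q v x = η′-Y q v .proj₂ (inj₁ (η′-X q v .proj₁ x))
    η′⊨ X∉γ Y∉γ η⊨γ {Z} {Z′} (there Z≼Z′) q v x =
      η′-other Z′ (λ { refl → X∉γ (Z , inj₂ Z≼Z′) }) (λ { refl → Y∉γ (Z , inj₂ Z≼Z′) }) q v .proj₂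
        (η⊨γ Z≼Z′ q v (η′-other Z (λ { refl → X∉γ (Z′ , inj₁ Z≼Z′) })
                                  (λ { refl → Y∉γ (Z′ , inj₁ Z≼Z′) }) q v .proj₁ x))

    η≈η′ : ∀ C → ¬ X ∈FTV C → ¬ Y ∈FTV C → AgreeOn C η η′
    η≈η′ C X∉C Y∉C Z Z∈C q v =
      ⇔-sym (η′-other Z (λ { refl → X∉C Z∈C }) (λ { refl → Y∉C Z∈C }) q v)

    fold-A : ¬ X ∈FTV A → ¬ Y ∈FTV A → ∀ p u → 𝓘 η (μ A) p u → 𝓘 η′ (open′ A (fvar X)) p u
    fold-A X∉A Y∉A p u =
      𝓘-openAt-cong A (μA-wf .proj₁) (μA-wf .proj₂) (η≈η′ A X∉A Y∉A) μA-wf tt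
        (λ _ v → ⇔-sym (η′-X _ v)) u .proj₁
      ∘ 𝓘-μ A μA-wf u .proj₁

    unfold-B : ¬ X ∈FTV B → ¬ Y ∈FTV B → ∀ {p} → □⁺ (λ q → ∀ v → 𝓘 η (μ A) q v → 𝓘 η (μ B) q v) p →
      ∀ u → 𝓘 η′ (open′ B (fvar Y)) p u → 𝓘 η (μ B) p u
    unfold-B X∉B Y∉B μA⊆μB u =
      𝓘-μ B μB-wf u .proj₂
      ∘ 𝓘-openAt-cong B (μB-wf .proj₁) (μB-wf .proj₂) η′≈η tt μB-wf Y≈μB u .proj₁
      where
      η′≈η : AgreeOn B η′ η
      η′≈η Z Z∈B q v = ⇔-sym (η≈η′ B X∉B Y∉B Z Z∈B q v)
      Y≈μB : □⁺ (λ q → ∀ v → η′ Y q v ⇔ 𝓘 η (μ B) q v) _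
      Y≈μB h v = ⇔-trans (η′-Y _ v) ((λ { (inj₁ x) → μA⊆μB h v x ; (inj₂ y) → y }) , inj₂)

  𝓘-≼ : ∀ {γ A B} → γ ⊢ A ≼ B → ∀ η → Hereditary η → η ⊨ γ → ∀ p u → 𝓘 η A p u → 𝓘 η B p u
  𝓘-≼ (≼-set γ≋γ′ A≼B)   η η-her η⊨γ′ = 𝓘-≼ A≼B η η-her (η⊨γ′ ∘ proj₁ (γ≋γ′ _))
  𝓘-≼ (≼-hyp _ X≼Y)       η η-her η⊨γ  = η⊨γ X≼Y
  𝓘-≼ (≼-⊤ _ _)           η η-her η⊨γ p u _ = 𝓘-top ⊤ᵗ refl p u
  𝓘-≼ (≼-≃ _ A≃B)         η η-her η⊨γ p u = 𝓘-≃ η-her A≃B p u .proj₁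
  𝓘-≼ (≼-trans {γ₁} _ A≼B B≼C) η η-her η⊨γ p u =
    𝓘-≼ B≼C η η-her (⊨-++ʳ γ₁ η⊨γ) p u ∘ 𝓘-≼ A≼B η η-her (⊨-++ˡ γ₁ η⊨γ) p u
  𝓘-≼ (≼-● {A = A} {B} A≼B) η η-her η⊨γ p u x =
    let (A-wf , B-wf) = ≼⇒TypeExpr A≼B in
    𝓘-● B B-wf u .proj₂ λ q p▷q → 𝓘-≼ A≼B η η-her η⊨γ q u (𝓘-● A A-wf u .proj₁ x q p▷q)
  𝓘-≼ (≼-⇒ {γ₁} {A = A} {A′} {B} {B′} _ A′≼A B≼B′) η η-her η⊨γ p u x =
    let (A′-wf , A-wf) = ≼⇒TypeExpr A′≼A
        (B-wf , B′-wf) = ≼⇒TypeExpr B≼B′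
    in 𝓘-⇒ A′ B′ A′-wf B′-wf u .proj₂ λ q p▷*q v y →
         𝓘-≼ B≼B′ η η-her (⊨-++ʳ γ₁ η⊨γ) q (u · v)
           (𝓘-⇒ A B A-wf B-wf u .proj₁ x q p▷*q v (𝓘-≼ A′≼A η η-her (⊨-++ˡ γ₁ η⊨γ) q v y))
  𝓘-≼ (≼-next {A = A} _ A-wf) η η-her η⊨γ p u x =
    𝓘-● A A-wf u .proj₂ λ q p▷q → 𝓘-hereditary η-her A A-wf p▷q u x
  𝓘-≼ μA≼μB@(≼-μ {A = A} {B} X Y X∉A Y∉B γ-ok X∉γ X∉B′ Y∉γ Y∉A′ _ _ A≼B) η η-her η⊨γ p =
    go (▷⁺-wellFounded p)
    where
    open μ-Rule η-her (proj₁ γ-ok (here refl)) (proj₁ (≼⇒TypeExpr μA≼μB)) (proj₂ (≼⇒TypeExpr μA≼μB))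
    go : ∀ {p} → Accessible p → ∀ u → 𝓘 η (μ A) p u → 𝓘 η (μ B) p u
    go {p} (acc rs) u =
      unfold-B (X∉B′ ∘ ∈FTV-openAt B) Y∉B (λ h → go (rs h)) u
      ∘ 𝓘-≼ A≼B η′ η′-hereditary (η′⊨ X∉γ Y∉γ η⊨γ) p u
      ∘ fold-A X∉A (Y∉A′ ∘ ∈FTV-openAt A) p u

theorem5p4 : (𝓐 : LambdaAlgebra) (𝓕 : Frame) →
    (η : Semantics.TyEnv 𝓐 𝓕) → Semantics.Hereditary 𝓐 𝓕 η →
    (I : Ty → Frame.W 𝓕 → LambdaAlgebra.V 𝓐 → Set) →
    Semantics.IsInterpretation 𝓐 𝓕 η I →
    ∀ {γ A B} → γ ⊢ A ≼ B → Semantics._⊨_ 𝓐 𝓕 η γ →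
    ∀ (p : Frame.W 𝓕) (u : LambdaAlgebra.V 𝓐) → I A p u → I B p u
theorem5p4 𝓐 𝓕 η η-her I isI {A = A} {B} A≼B η⊨γ p u =
  proj₂ (interpretation-unique B B-wf p u)
  ∘ 𝓘-≼ A≼B η η-her η⊨γ p u
  ∘ proj₁ (interpretation-unique A A-wf p u)
  where
  open Interpretation 𝓐 𝓕
  open Uniqueness isI (𝓘-isInterpretation η)
  A-wf = proj₁ (≼⇒TypeExpr A≼B)
  B-wf = proj₂ (≼⇒TypeExpr A≼B)
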